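{- For $k\ge2$, $\zeta>0$, and a $k$-uniform constellation $\Psi$, there are at most $(k-2)\zeta|V(\Psi)|^{2k-3}$ walks $x_1\dots x_{2k-3}$ in $H(\Psi)$ such that (a) $x_{k-1}\in V(R^\Psi_{\{x_k,\dots,x_{2k-3}\}})$ but (b) $(x_1,\dots,x_{k-1})$ fails to be $\zeta$-leftconnectable in $\Psi$.
   Context: A $k$-uniform hypergraph is $H=(V,E)$ with $E$ a set of $k$-element subsets of $V$. A sequence $(x_1,\dots,x_m)$ with $m\ge k-1$ is a walk in $H$ if $\{x_j,\dots,x_{j+k-1}\}\in E$ for every $j\in[m-k+1]$ (for $m=k-1$ there is no condition). For $S\subseteq V$, $|S|\le k-2$, $\overline H_S$ is the hypergraph on $V\setminus S$ with edges $\{e\setminus S:S\subseteq e\in E\}$, and $H_S$ has the same edges on vertex set $V$. A $k$-uniform constellation ($k\ge 2$) is $\Psi=(H,\{R_x:x\in V(H)^{(k-2)}\})$ with $H$ $k$-uniform and each $R_x$ an induced subgraph of the graph $H_x$ (for $k=2$ only $R_\emptyset\subseteq H$); $H(\Psi)=H$, $V(\Psi)=V(H)$, $E(\Psi)=E(H)$, $R^\Psi_x=R_x$. For $|S|\le k-2$, $\Psi_S=(\overline H_S,\{R_{x\cup S}-S:x\in(V(H)\setminus S)^{(k-2-|S|)}\})$, $\Psi_z=\Psi_{\{z\}}$. Recursively, a $(k-1)$-tuple $(x_1,\dots,x_{k-1})$ of distinct vertices is $\zeta$-leftconnectable in $\Psi$ if for $k=2$: $x_1\in V(R_\emptyset)$;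 for $k\ge3$: at least $\zeta|V(\Psi)|$ vertices $z$ satisfy $\{x_1,\dots,x_{k-1},z\}\in E(\Psi)$ and $(x_2,\dots,x_{k-1})$ is $\zeta$-leftconnectable in $\Psi_z$.
   Formalization: The parameter ζ ranges over the positive rationals. -}

module Defs where

open import Data.Nat using (ℕ; zero; suc; _+_; _∸_; _≤_; _^_)
open import Data.Fin using (Fin)
open import Data.Fin.Subset using (Subset; ⊥; ⁅_⁆; _∪_; _∈_; _∉_; _⊆_; _-_; ∣_∣)
open import Data.List using (List; []; _∷_; foldr; length; take; drop)
open import Data.List.Relation.Unary.All using (All)
open import Data.List.Relation.Unary.Unique.Propositional using (Unique)
open import Data.Product using (Σ; _×_; ∃)
open import Data.Integer using (+_)
open import Data.Rational using (ℚ; _/_) renaming (_≤_ to _≤ℚ_; _*_ to _*ℚ_)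

toSub : ∀ {N} → List (Fin N) → Subset N
toSub = foldr (λ x s → ⁅ x ⁆ ∪ s) ⊥

ℕ→ℚ : ℕ → ℚ
ℕ→ℚ n = + n / 1

-- Raw data of a constellation on a subset V of the ambient vertex set Fin N.
--   V  : the vertex set V(Ψ)
--   E  : the edge predicate of H(Ψ) (edges are subsets of Fin N)
--   R  : x ↦ V(R_x), the vertex set of the graph R_x (x ranges over the
--        (k-2)-subsets of V; values at other subsets are irrelevant).
-- Since each R_x is an *induced* subgraph of H_x (resp. for k = 2 only its
-- vertex set enters the statement), R_x is determined by / only used via
-- its vertex set.
record Constellation (N : ℕ) : Set₁ where
  field
    V : Subset N
    E : Subset N → Set
    R : Subset N → Subset N
open Constellation public

IsConstellation : ∀ {N} → ℕ → Constellation N → Set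
IsConstellation {N} k Ψ =
  (2 ≤ k)
  × (∀ e → E Ψ e → (∣ e ∣ ≡ k) × (e ⊆ V Ψ))
  × (∀ x → R Ψ x ⊆ V Ψ)
  where open import Relation.Binary.PropositionalEquality using (_≡_)

_₍_₎ : ∀ {N} → Constellation N → Fin N → Constellation N
Ψ ₍ z ₎ = record
  { V = V Ψ - z
  ; E = λ e → (z ∉ e) × E Ψ (e ∪ ⁅ z ⁆)
  ; R = λ x → R Ψ (x ∪ ⁅ z ⁆) - z
  }

-- ζ-leftconnectable (x₁,…,x_{k-1}) in a k-uniform constellation Ψ; the
-- uniformity k is determined by the length k-1 of the tuple.
--  * k = 2  : x₁ ∈ V(R_∅)
--  * k ≥ 3  : at least ζ|V(Ψ)| vertices z (i.e. a duplicate-free list of such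
--             z of length ≥ ζ|V(Ψ)|) with {x₁,…,x_{k-1},z} ∈ E(Ψ) and
--             (x₂,…,x_{k-1}) ζ-leftconnectable in Ψ_z.
LeftConnectable : ∀ {N} → ℚ → Constellation N → List (Fin N) → Set
LeftConnectable ζ Ψ [] = Data.Empty.⊥
  where import Data.Empty
LeftConnectable ζ Ψ (x ∷ []) = x ∈ R Ψ ⊥
LeftConnectable ζ Ψ (x ∷ y ∷ xs) =
  Σ (List _) λ zs →
    Unique zs
    × (ζ *ℚ ℕ→ℚ ∣ V Ψ ∣ ≤ℚ ℕ→ℚ (length zs))
    × All (λ z → (z ∈ V Ψ)
                 × E Ψ (toSub (x ∷ y ∷ xs) ∪ ⁅ z ⁆)
                 × LeftConnectable ζ (Ψ ₍ z ₎) (y ∷ xs)) zs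

IsWalk : ∀ {N} → ℕ → Subset N → (Subset N → Set) → List (Fin N) → Set
IsWalk k V E xs =
  All (_∈ V) xs
  × (k ∸ 1 ≤ length xs)
  × (∀ j → j + k ≤ length xs → E (toSub (take k (drop j xs))))

module Submission where

-- Lemma 2.20.  Write k = m + 2 and n = |V(Ψ)|.  A counted walk has the form
-- w = t · post, where t = (x₁,…,x_{k-1}) and post = (x_k,…,x_{2k-3}).  Consider
-- the iterated links Ψ_a of Ψ along the prefixes a of post.  By (a) the 1-tuple
-- (x_{k-1}) is left-connectable in Ψ_post, while by (b) t is not
-- left-connectable in Ψ; hence there is a split post = a · z · b such that the
-- suffix s of t of length k-1-|a| is not left-connectable in Ψ_a, but its tail
-- is left-connectable in Ψ_{a·z}.  Since s·a·z is a window of the walk, z is an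
-- "extender" of s in Ψ_a, and a non-left-connectable tuple has at most ζn
-- extenders.  So w is determined by the key (|a|, w with z deleted), which
-- takes at most m·n^{2m} values, together with one of at most ζn extenders:
-- this gives m·ζ·n^{2m+1} = (k-2)·ζ·n^{2k-3}.  Constructively the split is only
-- found under a double negation, which is harmless as the bound is decidable.

open import Defs
open import Data.Nat using (ℕ; _∸_; _*_; _^_)
open import Data.Fin using (Fin)
open import Data.Fin.Subset using (_∈_; ∣_∣)
open import Data.List using (List; []; _∷_; _++_; length)
open import Data.List.Relation.Unary.All using (All)
open import Data.List.Relation.Unary.Unique.Propositional using (Unique)
open import Data.Product using (Σ; _×_)
open import Relation.Binary.PropositionalEquality using (_≡_)
open import Relation.Nullary using (¬_)
open import Data.Rational using (ℚ; 0ℚ; _<_; _≤_) renaming (_*_ to _*ℚ_)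

open import Data.Nat as ℕ using (zero; suc)
import Data.Nat.Properties as ℕP
open import Data.Integer as ℤ using (+_)
import Data.Integer.Properties as ℤP
open import Data.Rational as ℚ using (mkℚ; 1ℚ) renaming (_+_ to _+ℚ_)
import Data.Rational.Properties as ℚP
open import Data.Rational.Solver using (module +-*-Solver)
open import Data.Nat.Coprimality using (1-coprimeTo) renaming (sym to coprime-sym)
open import Data.Nat.Tactic.RingSolver using (solve-∀)
open import Data.Fin using (zero; suc; _≟_)
open import Data.Fin.Subset using (Subset; ⊥; ⁅_⁆; _∪_; _⊆_) renaming (_∉_ to _∉ˢ_)
open import Data.Fin.Subset.Properties
  using (x∈p∪q⁻; x∈p∪q⁺; x∈⁅y⁆⇒x≡y; x∈⁅x⁆; x∈p∧x≢y⇒x∈p-y; ∉⊥; ∣⊥∣≡0; ∪-assoc; ∪-comm;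
         ∪-identityˡ; ∪-identityʳ; ∣p─q∣≤∣p∣; p⊆q⇒∣p∣≤∣q∣)
open import Data.Bool using (true; false)
open import Data.Vec using ([]; _∷_)
open import Data.Vec.Base using (_[_]=_)
open _[_]=_ using () renaming (there to there-∈)
open import Data.List using (map; drop; take; filter; upTo; cartesianProductWith; cartesianProduct; initLast; _∷ʳ′_)
open import Data.List.Properties
  using (length-++; length-map; length-drop; length-upTo; drop-drop; take++drop≡id; ++-assoc;
         ++-identityʳ; ∷-injective)
import Data.List.Properties as ListP
open import Data.List.Relation.Unary.All as All using ([]; _∷_)
import Data.List.Relation.Unary.All.Properties as AllP
open import Data.List.Relation.Unary.AllPairs using (AllPairs; []; _∷_)
import Data.List.Relation.Unary.AllPairs.Properties as AllPairsP
import Data.List.Relation.Unary.Unique.Propositional.Properties as UniqueP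
open import Data.List.Relation.Unary.Any using (here; there)
open import Data.List.Membership.Propositional using () renaming (_∈_ to _∈ₗ_; _∉_ to _∉ₗ_)
open import Data.List.Membership.Propositional.Properties using (∈-map⁺; ∈-++⁺ˡ; ∈-upTo⁺; ∈-cartesianProductWith⁺; ∈-cartesianProduct⁺)
open import Data.Product using (_,_; proj₁; proj₂)
import Data.Product.Properties as ProductP
open import Data.Sum using (inj₁; inj₂)
open import Data.Empty using (⊥-elim)
open import Function using (_∘_)
open import Relation.Binary.PropositionalEquality using (refl; sym; trans; cong; cong₂; subst; subst₂; _≢_; module ≡-Reasoning)
open import Relation.Binary.Definitions using (DecidableEquality)
open import Relation.Nullary using (yes; no; ¬?; contradiction)
open import Relation.Nullary.Negation using (¬¬-map)
open import Relation.Nullary.Decidable using (decidable-stable)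
open import Relation.Unary using (Decidable)


ℕ→ℚ-mkℚ : ∀ n → ℕ→ℚ n ≡ mkℚ (+ n) 0 (coprime-sym (1-coprimeTo n))
ℕ→ℚ-mkℚ n = ℚP.normalize-coprime (coprime-sym (1-coprimeTo n))

ℕ→ℚ-+ : ∀ a b → ℕ→ℚ (a ℕ.+ b) ≡ ℕ→ℚ a +ℚ ℕ→ℚ b
ℕ→ℚ-+ a b = trans (ℚP./-cong {+ (a ℕ.+ b)} +-over-1 refl) (sym (cong₂ _+ℚ_ (ℕ→ℚ-mkℚ a) (ℕ→ℚ-mkℚ b)))
  where
  +-over-1 : + (a ℕ.+ b) ≡ + a ℤ.* + 1 ℤ.+ + b ℤ.* + 1
  +-over-1 = cong₂ ℤ._+_ (sym (ℤP.*-identityʳ (+ a))) (sym (ℤP.*-identityʳ (+ b)))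

ℕ→ℚ-* : ∀ a b → ℕ→ℚ (a ℕ.* b) ≡ ℕ→ℚ a *ℚ ℕ→ℚ b
ℕ→ℚ-* a b = trans (ℚP./-cong {+ (a ℕ.* b)} (ℤP.pos-* a b) refl) (sym (cong₂ _*ℚ_ (ℕ→ℚ-mkℚ a) (ℕ→ℚ-mkℚ b)))

ℕ→ℚ-mono : ∀ {a b} → a ℕ.≤ b → ℕ→ℚ a ≤ ℕ→ℚ b
ℕ→ℚ-mono {a} {b} a≤b =
  subst₂ _≤_ (sym (ℕ→ℚ-mkℚ a)) (sym (ℕ→ℚ-mkℚ b)) (ℚ.*≤* (ℤP.*-monoʳ-≤-nonNeg (+ 1) (ℤ.+≤+ a≤b)))

ζ*-mono : ∀ {ζ} → 0ℚ ≤ ζ → ∀ {a b} → a ℕ.≤ b → ζ *ℚ ℕ→ℚ a ≤ ζ *ℚ ℕ→ℚ b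
ζ*-mono {ζ} ζ≥0 a≤b = ℚP.*-monoˡ-≤-nonNeg ζ {{ℚ.nonNegative ζ≥0}} (ℕ→ℚ-mono a≤b)

0≤ζ* : ∀ {ζ} → 0ℚ ≤ ζ → ∀ n → 0ℚ ≤ ζ *ℚ ℕ→ℚ n
0≤ζ* {ζ} ζ≥0 n = ℚP.≤-trans (ℚP.≤-reflexive (sym (ℚP.*-zeroʳ ζ))) (ζ*-mono ζ≥0 {0} {n} ℕ.z≤n)

length-filter-split : ∀ {A : Set} {P : A → Set} (P? : Decidable P) (xs : List A) →
  length xs ≡ length (filter P? xs) ℕ.+ length (filter (¬? ∘ P?) xs)
length-filter-split P? [] = refl
length-filter-split P? (x ∷ xs) with P? x
... | yes _ = cong suc (length-filter-split P? xs)
... | no _ = trans (cong suc (length-filter-split P? xs)) (sym (ℕP.+-suc _ _))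

count-by-key : ∀ {A K : Set} (_≟ₖ_ : DecidableEquality K) (key : A → K) (R : A → A → Set) (c : ℚ)
  (ks : List K) (ds : List A) → AllPairs R ds → All (λ d → key d ∈ₗ ks) ds →
  (∀ κ ys → AllPairs R ys → All (λ d → key d ≡ κ) ys → ℕ→ℚ (length ys) ≤ c) →
  ℕ→ℚ (length ds) ≤ ℕ→ℚ (length ks) *ℚ c
count-by-key _ _ _ c [] [] _ _ _ = ℚP.≤-reflexive (sym (ℚP.*-zeroˡ c))
count-by-key _ _ _ _ [] (_ ∷ _) _ (() ∷ _) _
count-by-key {A} _≟ₖ_ key R c (κ ∷ ks) ds separated keys∈ fibre =
  begin
    ℕ→ℚ (length ds)
  ≡⟨ cong ℕ→ℚ (length-filter-split has-κ? ds) ⟩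
    ℕ→ℚ (length (filter has-κ? ds) ℕ.+ length others)
  ≡⟨ ℕ→ℚ-+ (length (filter has-κ? ds)) (length others) ⟩
    ℕ→ℚ (length (filter has-κ? ds)) +ℚ ℕ→ℚ (length others)
  ≤⟨ ℚP.+-mono-≤ bound-κ bound-others ⟩
    c +ℚ ℕ→ℚ (length ks) *ℚ c
  ≡⟨ solve 2 (λ c L → c :+ L :* c := (con 1ℚ :+ L) :* c) refl c (ℕ→ℚ (length ks)) ⟩
    (1ℚ +ℚ ℕ→ℚ (length ks)) *ℚ c
  ≡⟨ cong (_*ℚ c) (sym (ℕ→ℚ-+ 1 (length ks))) ⟩
    ℕ→ℚ (length (κ ∷ ks)) *ℚ c
  ∎
  where
  open ℚP.≤-Reasoning
  open +-*-Solver
  has-κ? : Decidable (λ d → key d ≡ κ)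
  has-κ? d = key d ≟ₖ κ
  others : List A
  others = filter (¬? ∘ has-κ?) ds
  bound-κ : ℕ→ℚ (length (filter has-κ? ds)) ≤ c
  bound-κ = fibre κ _ (AllPairsP.filter⁺ has-κ? separated) (AllP.all-filter has-κ? ds)
  others∈ks : All (λ d → key d ∈ₗ ks) others
  others∈ks = All.zipWith in-tail (AllP.all-filter (¬? ∘ has-κ?) ds , AllP.filter⁺ (¬? ∘ has-κ?) keys∈)
    where
    in-tail : ∀ {d} → key d ≢ κ × key d ∈ₗ κ ∷ ks → key d ∈ₗ ks
    in-tail (≢κ , here ≡κ) = contradiction ≡κ ≢κ
    in-tail (_ , there ∈ks) = ∈ks
  bound-others : ℕ→ℚ (length others) ≤ ℕ→ℚ (length ks) *ℚ c
  bound-others = count-by-key _≟ₖ_ key R c ks others (AllPairsP.filter⁺ _ separated) others∈ks fibre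

elements : ∀ {n} → Subset n → List (Fin n)
elements [] = []
elements (true ∷ p) = zero ∷ map suc (elements p)
elements (false ∷ p) = map suc (elements p)

length-elements : ∀ {n} (p : Subset n) → length (elements p) ≡ ∣ p ∣
length-elements [] = refl
length-elements (true ∷ p) = cong suc (trans (length-map suc (elements p)) (length-elements p))
length-elements (false ∷ p) = trans (length-map suc (elements p)) (length-elements p)

∈-elements : ∀ {n} (p : Subset n) {x} → x ∈ p → x ∈ₗ elements p
∈-elements (true ∷ p) {zero} _ = here refl
∈-elements (true ∷ p) {suc x} (there-∈ x∈p) = there (∈-map⁺ suc (∈-elements p x∈p))
∈-elements (false ∷ p) {suc x} (there-∈ x∈p) = ∈-map⁺ suc (∈-elements p x∈p)

length-cartesianProductWith : ∀ {A B C : Set} (f : A → B → C) (xs : List A) (ys : List B) →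
  length (cartesianProductWith f xs ys) ≡ length xs ℕ.* length ys
length-cartesianProductWith f [] ys = refl
length-cartesianProductWith f (x ∷ xs) ys =
  trans (length-++ (map (f x) ys)) (cong₂ ℕ._+_ (length-map (f x) ys) (length-cartesianProductWith f xs ys))

words : ∀ {n} → Subset n → ℕ → List (List (Fin n))
words V zero = [] ∷ []
words V (suc L) = cartesianProductWith _∷_ (elements V) (words V L)

length-words : ∀ {n} (V : Subset n) L → length (words V L) ≡ ∣ V ∣ ^ L
length-words V zero = refl
length-words V (suc L) =
  trans (length-cartesianProductWith _∷_ (elements V) (words V L))
        (cong₂ ℕ._*_ (length-elements V) (length-words V L))

∈-words : ∀ {n} (V : Subset n) (l : List (Fin n)) → All (_∈ V) l → l ∈ₗ words V (length l)
∈-words V [] _ = here refl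
∈-words V (x ∷ l) (x∈V ∷ l⊆V) = ∈-cartesianProductWith⁺ _∷_ (∈-elements V x∈V) (∈-words V l l⊆V)

drop-length-++ : ∀ {A : Set} (xs ys : List A) → drop (length xs) (xs ++ ys) ≡ ys
drop-length-++ [] ys = refl
drop-length-++ (x ∷ xs) ys = drop-length-++ xs ys

take-length-++ : ∀ {A : Set} (xs ys : List A) → take (length xs) (xs ++ ys) ≡ xs
take-length-++ [] ys = refl
take-length-++ (x ∷ xs) ys = cong (x ∷_) (take-length-++ xs ys)

++-injective : ∀ {A : Set} (xs ys : List A) {xs′ ys′ : List A} → length xs ≡ length ys →
  xs ++ xs′ ≡ ys ++ ys′ → xs ≡ ys × xs′ ≡ ys′
++-injective [] [] _ eq = refl , eq
++-injective (x ∷ xs) (y ∷ ys) |xs|≡|ys| eq with ∷-injective eq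
... | x≡y , eq′ with ++-injective xs ys (ℕP.suc-injective |xs|≡|ys|) eq′
... | xs≡ys , xs′≡ys′ = cong₂ _∷_ x≡y xs≡ys , xs′≡ys′

unique-++⁻ : ∀ {A : Set} (xs ys : List A) → Unique (xs ++ ys) →
  Unique xs × Unique ys × (∀ {p q} → p ∈ₗ xs → q ∈ₗ ys → p ≢ q)
unique-++⁻ [] ys u = [] , u , λ ()
unique-++⁻ (x ∷ xs) ys (x∉ ∷ u) with unique-++⁻ xs ys u
... | u-xs , u-ys , disjoint = (AllP.++⁻ˡ xs x∉ ∷ u-xs) , u-ys , disjoint′
  where
  disjoint′ : ∀ {p q} → p ∈ₗ x ∷ xs → q ∈ₗ ys → p ≢ q
  disjoint′ (here refl) q∈ys = All.lookup (AllP.++⁻ʳ xs x∉) q∈ys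
  disjoint′ (there p∈xs) q∈ys = disjoint p∈xs q∈ys

∈-toSub⁻ : ∀ {N} {x : Fin N} (l : List (Fin N)) → x ∈ toSub l → x ∈ₗ l
∈-toSub⁻ [] x∈ = ⊥-elim (∉⊥ x∈)
∈-toSub⁻ (y ∷ l) x∈ with x∈p∪q⁻ ⁅ y ⁆ (toSub l) x∈
... | inj₁ x∈⁅y⁆ = here (x∈⁅y⁆⇒x≡y y x∈⁅y⁆)
... | inj₂ x∈l = there (∈-toSub⁻ l x∈l)

∈-toSub⁺ : ∀ {N} {x : Fin N} (l : List (Fin N)) → x ∈ₗ l → x ∈ toSub l
∈-toSub⁺ (y ∷ l) (here refl) = x∈p∪q⁺ (inj₁ (x∈⁅x⁆ y))
∈-toSub⁺ (y ∷ l) (there x∈l) = x∈p∪q⁺ (inj₂ (∈-toSub⁺ l x∈l))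

toSub-++ : ∀ {N} (l₁ l₂ : List (Fin N)) → toSub (l₁ ++ l₂) ≡ toSub l₁ ∪ toSub l₂
toSub-++ [] l₂ = sym (∪-identityˡ _)
toSub-++ (y ∷ l₁) l₂ = trans (cong (⁅ y ⁆ ∪_) (toSub-++ l₁ l₂)) (sym (∪-assoc ⁅ y ⁆ _ _))

∣⁅x⁆∪p∣≤ : ∀ {N} (x : Fin N) (p : Subset N) → ∣ ⁅ x ⁆ ∪ p ∣ ℕ.≤ suc ∣ p ∣
∣⁅x⁆∪p∣≤ zero (true ∷ p) = ℕ.s≤s (ℕP.m≤n⇒m≤1+n (ℕP.≤-reflexive (cong ∣_∣ (∪-identityˡ p))))
∣⁅x⁆∪p∣≤ zero (false ∷ p) = ℕ.s≤s (ℕP.≤-reflexive (cong ∣_∣ (∪-identityˡ p)))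
∣⁅x⁆∪p∣≤ (suc x) (true ∷ p) = ℕ.s≤s (∣⁅x⁆∪p∣≤ x p)
∣⁅x⁆∪p∣≤ (suc x) (false ∷ p) = ∣⁅x⁆∪p∣≤ x p

⁅x⁆∪p⊆p : ∀ {N} {x : Fin N} (p : Subset N) → x ∈ p → ⁅ x ⁆ ∪ p ⊆ p
⁅x⁆∪p⊆p {x = x} p x∈p y∈ with x∈p∪q⁻ ⁅ x ⁆ p y∈
... | inj₁ y∈⁅x⁆ = subst (_∈ p) (sym (x∈⁅y⁆⇒x≡y x y∈⁅x⁆)) x∈p
... | inj₂ y∈p = y∈p

∣toSub∣≤length : ∀ {N} (l : List (Fin N)) → ∣ toSub l ∣ ℕ.≤ length l
∣toSub∣≤length {N} [] = ℕP.≤-reflexive (∣⊥∣≡0 N)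
∣toSub∣≤length (x ∷ l) = ℕP.≤-trans (∣⁅x⁆∪p∣≤ x (toSub l)) (ℕ.s≤s (∣toSub∣≤length l))

unique-from-size : ∀ {N} (l : List (Fin N)) → ∣ toSub l ∣ ≡ length l → Unique l
unique-from-size [] _ = []
unique-from-size (x ∷ l) size = AllP.¬Any⇒All¬ l x∉l ∷ unique-from-size l size-l
  where
  size-l : ∣ toSub l ∣ ≡ length l
  size-l = ℕP.≤-antisym (∣toSub∣≤length l)
             (ℕ.s≤s⁻¹ (ℕP.≤-trans (ℕP.≤-reflexive (sym size)) (∣⁅x⁆∪p∣≤ x (toSub l))))
  x∉l : x ∉ₗ l
  x∉l x∈l = ℕP.<-irrefl refl (ℕP.≤-trans (ℕP.≤-reflexive (sym size))
              (ℕP.≤-trans (p⊆q⇒∣p∣≤∣q∣ (⁅x⁆∪p⊆p (toSub l) (∈-toSub⁺ l x∈l))) (∣toSub∣≤length l)))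

window-edge : ∀ {N k} {V : Subset N} {E : Subset N → Set} (u v u′ : List (Fin N)) →
  IsWalk k V E (u ++ v ++ u′) → length v ≡ k → E (toSub v)
window-edge {k = k} {E = E} u v u′ (_ , _ , edges) |v|≡k =
  subst (E ∘ toSub) window≡v (edges (length u) fits)
  where
  window≡v : take k (drop (length u) (u ++ v ++ u′)) ≡ v
  window≡v = trans (cong (take k) (drop-length-++ u (v ++ u′)))
                   (subst (λ j → take j (v ++ u′) ≡ v) |v|≡k (take-length-++ v u′))
  fits : length u ℕ.+ k ℕ.≤ length (u ++ v ++ u′)
  fits = subst₂ ℕ._≤_ (cong (length u ℕ.+_) |v|≡k)
           (sym (trans (length-++ u) (cong (length u ℕ.+_) (length-++ v))))
           (ℕP.+-monoʳ-≤ (length u) (ℕP.m≤m+n (length v) (length u′)))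

window-unique : ∀ {N k} {V : Subset N} {E : Subset N → Set} → (∀ e → E e → ∣ e ∣ ≡ k) →
  (u v u′ : List (Fin N)) → IsWalk k V E (u ++ v ++ u′) → length v ≡ k → Unique v
window-unique {E = E} uniform u v u′ walk |v|≡k =
  unique-from-size v (trans (uniform (toSub v) (window-edge {E = E} u v u′ walk |v|≡k)) (sym |v|≡k))

link : ∀ {N} → Constellation N → List (Fin N) → Constellation N
link Φ [] = Φ
link Φ (p ∷ ps) = link (Φ ₍ p ₎) ps

link-∷ʳ : ∀ {N} (Φ : Constellation N) ps p → link Φ (ps ++ p ∷ []) ≡ link Φ ps ₍ p ₎
link-∷ʳ Φ [] p = refl
link-∷ʳ Φ (q ∷ ps) p = link-∷ʳ (Φ ₍ q ₎) ps p

∣V-link∣≤ : ∀ {N} (Φ : Constellation N) ps → ∣ V (link Φ ps) ∣ ℕ.≤ ∣ V Φ ∣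
∣V-link∣≤ Φ [] = ℕP.≤-refl
∣V-link∣≤ Φ (p ∷ ps) = ℕP.≤-trans (∣V-link∣≤ (Φ ₍ p ₎) ps) (∣p─q∣≤∣p∣ (V Φ) ⁅ p ⁆)

∈-V-link : ∀ {N} (Φ : Constellation N) ps {z} → z ∈ V Φ → All (z ≢_) ps → z ∈ V (link Φ ps)
∈-V-link Φ [] z∈V _ = z∈V
∈-V-link Φ (p ∷ ps) z∈V (z≢p ∷ z∉ps) = ∈-V-link (Φ ₍ p ₎) ps (x∈p∧x≢y⇒x∈p-y z∈V z≢p) z∉ps

∪-rotate : ∀ {N} (e p q : Subset N) → e ∪ (p ∪ q) ≡ (e ∪ q) ∪ p
∪-rotate e p q = trans (cong (e ∪_) (∪-comm p q)) (sym (∪-assoc e q p))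

∈-R-link : ∀ {N} (Φ : Constellation N) ps s {x} → All (x ≢_) ps →
  x ∈ R Φ (s ∪ toSub ps) → x ∈ R (link Φ ps) s
∈-R-link Φ [] s _ x∈R = subst (λ t → _ ∈ R Φ t) (∪-identityʳ s) x∈R
∈-R-link Φ (p ∷ ps) s (x≢p ∷ x∉ps) x∈R =
  ∈-R-link (Φ ₍ p ₎) ps s x∉ps
    (x∈p∧x≢y⇒x∈p-y (subst (λ t → _ ∈ R Φ t) (∪-rotate s ⁅ p ⁆ (toSub ps)) x∈R) x≢p)

E-link : ∀ {N} (Φ : Constellation N) ps e → Unique ps → All (_∉ˢ e) ps →
  E Φ (e ∪ toSub ps) → E (link Φ ps) e
E-link Φ [] e _ _ edge = subst (E Φ) (∪-identityʳ e) edge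
E-link Φ (p ∷ ps) e (p∉ps ∷ u) (p∉e ∷ ps∉e) edge =
  E-link (Φ ₍ p ₎) ps e u ps∉e (p∉e∪ps , subst (E Φ) (∪-rotate e ⁅ p ⁆ (toSub ps)) edge)
  where
  p∉e∪ps : p ∉ˢ e ∪ toSub ps
  p∉e∪ps p∈ with x∈p∪q⁻ e (toSub ps) p∈
  ... | inj₁ p∈e = p∉e p∈e
  ... | inj₂ p∈ps = All.lookup p∉ps (∈-toSub⁻ ps p∈ps) refl

-- z extends the tuple t = (x₁,…,x_j) in Φ: it is one of the vertices counted
-- in the definition of "t is ζ-leftconnectable in Φ".
Extender : ∀ {N} → ℚ → Constellation N → List (Fin N) → Fin N → Set
Extender ζ Φ t z = (z ∈ V Φ) × E Φ (toSub t ∪ ⁅ z ⁆) × LeftConnectable ζ (Φ ₍ z ₎) (drop 1 t)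

few-extenders : ∀ {N} {ζ} → 0ℚ ≤ ζ → (Φ : Constellation N) (t : List (Fin N)) →
  ¬ LeftConnectable ζ Φ t → (zs : List (Fin N)) → Unique zs → All (Extender ζ Φ t) zs →
  ℕ→ℚ (length zs) ≤ ζ *ℚ ℕ→ℚ ∣ V Φ ∣
few-extenders ζ≥0 Φ _ _ [] _ _ = 0≤ζ* ζ≥0 ∣ V Φ ∣
few-extenders ζ≥0 Φ [] _ (z ∷ zs) _ ((_ , _ , ()) ∷ _)
few-extenders ζ≥0 Φ (x ∷ []) _ (z ∷ zs) _ ((_ , _ , ()) ∷ _)
few-extenders ζ≥0 Φ (x ∷ y ∷ xs) ¬lc zs@(_ ∷ _) u extenders =
  ℚP.<⇒≤ (ℚP.≰⇒> (λ enough → ¬lc (zs , u , enough , extenders)))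

window-extender : ∀ {N} {ζ} (Φ : Constellation N) (s a : List (Fin N)) (z : Fin N) →
  Unique (s ++ a ++ z ∷ []) → E Φ (toSub (s ++ a ++ z ∷ [])) → z ∈ V Φ →
  LeftConnectable ζ (link Φ a ₍ z ₎) (drop 1 s) → Extender ζ (link Φ a) s z
window-extender Φ s a z u edge z∈V lc = z∈V-link , edge-link , lc
  where
  u-s : Unique s × Unique (a ++ z ∷ []) × (∀ {p q} → p ∈ₗ s → q ∈ₗ a ++ z ∷ [] → p ≢ q)
  u-s = unique-++⁻ s (a ++ z ∷ []) u
  u-a : Unique a × Unique (z ∷ []) × (∀ {p q} → p ∈ₗ a → q ∈ₗ z ∷ [] → p ≢ q)
  u-a = unique-++⁻ a (z ∷ []) (proj₁ (proj₂ u-s))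
  z∈V-link : z ∈ V (link Φ a)
  z∈V-link = ∈-V-link Φ a z∈V (All.tabulate (λ p∈a z≡p → proj₂ (proj₂ u-a) p∈a (here refl) (sym z≡p)))
  a∉s∪z : All (_∉ˢ toSub s ∪ ⁅ z ⁆) a
  a∉s∪z = All.tabulate outside
    where
    outside : ∀ {p} → p ∈ₗ a → p ∉ˢ toSub s ∪ ⁅ z ⁆
    outside {p} p∈a p∈ with x∈p∪q⁻ (toSub s) ⁅ z ⁆ p∈
    ... | inj₁ p∈s = proj₂ (proj₂ u-s) (∈-toSub⁻ s p∈s) (∈-++⁺ˡ p∈a) refl
    ... | inj₂ p∈⁅z⁆ = proj₂ (proj₂ u-a) p∈a (here refl) (x∈⁅y⁆⇒x≡y z p∈⁅z⁆)
  vertices : toSub (s ++ a ++ z ∷ []) ≡ (toSub s ∪ ⁅ z ⁆) ∪ toSub a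
  vertices =
    begin
      toSub (s ++ a ++ z ∷ [])
    ≡⟨ toSub-++ s (a ++ z ∷ []) ⟩
      toSub s ∪ toSub (a ++ z ∷ [])
    ≡⟨ cong (toSub s ∪_) (trans (toSub-++ a (z ∷ [])) (cong (toSub a ∪_) (∪-identityʳ ⁅ z ⁆))) ⟩
      toSub s ∪ (toSub a ∪ ⁅ z ⁆)
    ≡⟨ ∪-rotate (toSub s) (toSub a) ⁅ z ⁆ ⟩
      (toSub s ∪ ⁅ z ⁆) ∪ toSub a
    ∎
    where open ≡-Reasoning
  edge-link : E (link Φ a) (toSub s ∪ ⁅ z ⁆)
  edge-link = E-link Φ a _ (proj₁ u-a) a∉s∪z (subst (E Φ) vertices edge)

record Boundary {A : Set} (Q : List A → Set) (ps : List A) : Set where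
  constructor boundary
  field
    a : List A
    z : A
    b : List A
    split : ps ≡ a ++ z ∷ b
    fails : ¬ Q a
    holds : Q (a ++ z ∷ [])

boundary-exists : ∀ {A : Set} (Q : List A → Set) (ps : List A) → ¬ Q [] → Q ps → ¬ ¬ Boundary Q ps
boundary-exists Q [] ¬Q[] Q[] _ = ¬Q[] Q[]
boundary-exists Q (p ∷ ps) ¬Q[] Qps no-boundary =
  boundary-exists (λ l → Q (p ∷ l)) ps ¬Q[p] Qps
    (λ (boundary a z b split fails holds) → no-boundary (boundary (p ∷ a) z b (cong (p ∷_) split) fails holds))
  where
  ¬Q[p] : ¬ Q (p ∷ [])
  ¬Q[p] Q[p] = no-boundary (boundary [] p ps refl ¬Q[] Q[p])

All-¬¬ : ∀ {A : Set} {P Q : A → Set} → (∀ {x} → P x → ¬ ¬ Q x) → ∀ {xs} → All P xs → ¬ ¬ All Q xs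
All-¬¬ f [] no-all = no-all []
All-¬¬ f (p ∷ ps) no-all = f p (λ q → All-¬¬ f ps (λ qs → no-all (q ∷ qs)))

map-proj₁-toList : ∀ {A : Set} {P : A → Set} {xs : List A} (ps : All P xs) → map proj₁ (All.toList ps) ≡ xs
map-proj₁-toList [] = refl
map-proj₁-toList (p ∷ ps) = cong (_ ∷_) (map-proj₁-toList ps)

window-split : ∀ {A : Set} (t a : List A) (z : A) (b : List A) j →
  t ++ a ++ z ∷ b ≡ take j t ++ (drop j t ++ a ++ z ∷ []) ++ b
window-split t a z b j =
  begin
    t ++ a ++ z ∷ b
  ≡⟨ cong (_++ a ++ z ∷ b) (sym (take++drop≡id j t)) ⟩
    (take j t ++ drop j t) ++ a ++ z ∷ b
  ≡⟨ ++-assoc (take j t) (drop j t) (a ++ z ∷ b) ⟩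
    take j t ++ drop j t ++ a ++ z ∷ b
  ≡⟨ cong (λ r → take j t ++ drop j t ++ r) (sym (++-assoc a (z ∷ []) b)) ⟩
    take j t ++ drop j t ++ (a ++ z ∷ []) ++ b
  ≡⟨ cong (take j t ++_) (sym (++-assoc (drop j t) (a ++ z ∷ []) b)) ⟩
    take j t ++ (drop j t ++ a ++ z ∷ []) ++ b
  ∎
  where open ≡-Reasoning

length-window : ∀ {A : Set} (t a : List A) (z : A) → length a ℕ.≤ length t →
  length (drop (length a) t ++ a ++ z ∷ []) ≡ suc (length t)
length-window t a z |a|≤|t| =
  begin
    length (drop A t ++ a ++ z ∷ [])
  ≡⟨ length-++ (drop A t) ⟩
    length (drop A t) ℕ.+ length (a ++ z ∷ [])
  ≡⟨ cong₂ ℕ._+_ (length-drop A t) (length-++ a) ⟩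
    (length t ∸ A) ℕ.+ (A ℕ.+ 1)
  ≡⟨ sym (ℕP.+-assoc (length t ∸ A) A 1) ⟩
    (length t ∸ A) ℕ.+ A ℕ.+ 1
  ≡⟨ cong (ℕ._+ 1) (ℕP.m∸n+n≡m |a|≤|t|) ⟩
    length t ℕ.+ 1
  ≡⟨ ℕP.+-comm (length t) 1 ⟩
    suc (length t)
  ∎
  where
  open ≡-Reasoning
  A : ℕ
  A = length a

module BadWalks {N : ℕ} (m : ℕ) (ζ : ℚ) (Ψ : Constellation N)
                (uniform : ∀ e → E Ψ e → ∣ e ∣ ≡ suc (suc m)) where

  k : ℕ
  k = suc (suc m)

  n : ℕ
  n = ∣ V Ψ ∣

  BadWalk : List (Fin N) → Set
  BadWalk w = Σ (List (Fin N)) λ pre → Σ (Fin N) λ x → Σ (List (Fin N)) λ post →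
    (w ≡ pre ++ (x ∷ post))
    × (length pre ≡ m)
    × (length post ≡ m)
    × IsWalk k (V Ψ) (E Ψ) w
    × (x ∈ R Ψ (toSub post))
    × ¬ LeftConnectable ζ Ψ (pre ++ (x ∷ []))

  SuffixConnects : List (Fin N) → List (Fin N) → Set
  SuffixConnects t a = LeftConnectable ζ (link Ψ a) (drop (length a) t)

  record Decomposition (w : List (Fin N)) : Set where
    field
      t a : List (Fin N)
      z : Fin N
      b : List (Fin N)
      shape : w ≡ t ++ a ++ z ∷ b
      |t| : length t ≡ suc m
      |ab| : suc (length a ℕ.+ length b) ≡ m
      in-V : All (_∈ V Ψ) (t ++ a ++ b)
      fails : ¬ SuffixConnects t a
      extends : Extender ζ (link Ψ a) (drop (length a) t) z

  -- x_{k-1} is distinct from x_k, …, x_{2k-3}: with x_{k-2} they form a window.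
  last-fresh : ∀ pre x post → IsWalk k (V Ψ) (E Ψ) (pre ++ x ∷ post) →
    length pre ≡ m → length post ≡ m → All (x ≢_) post
  last-fresh pre x [] _ _ _ = []
  last-fresh pre x post@(_ ∷ _) walk |pre| |post| with initLast pre
  ... | [] = contradiction (trans |pre| (sym |post|)) λ ()
  ... | pre₀ ∷ʳ′ y =
    fresh (window-unique uniform pre₀ (y ∷ x ∷ post) [] walk′ (cong (λ l → ℕ.suc (ℕ.suc l)) |post|))
    where
    walk′ : IsWalk k (V Ψ) (E Ψ) (pre₀ ++ (y ∷ x ∷ post) ++ [])
    walk′ = subst (IsWalk k (V Ψ) (E Ψ))
              (trans (++-assoc pre₀ (y ∷ []) (x ∷ post)) (cong (pre₀ ++_) (sym (++-identityʳ _)))) walk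
    fresh : Unique (y ∷ x ∷ post) → All (x ≢_) post
    fresh (_ ∷ x∉post ∷ _) = x∉post

  decomposition-at : ∀ pre x post → IsWalk k (V Ψ) (E Ψ) (pre ++ x ∷ post) →
    length pre ≡ m → length post ≡ m → Boundary (SuffixConnects (pre ++ x ∷ [])) post →
    Decomposition (pre ++ x ∷ post)
  decomposition-at pre x post walk |pre| |post| (boundary a z b split fails holds) =
    record { t = t ; a = a ; z = z ; b = b ; shape = shape ; |t| = |t| ; |ab| = |ab|
           ; in-V = AllP.++⁺ t-in-V (AllP.++⁺ a-in-V (All.tail zb-in-V))
           ; fails = fails ; extends = extends }
    where
    t : List (Fin N)
    t = pre ++ x ∷ []
    A : ℕ
    A = length a
    shape : pre ++ x ∷ post ≡ t ++ a ++ z ∷ b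
    shape = trans (sym (++-assoc pre (x ∷ []) post)) (cong (t ++_) split)
    |t| : length t ≡ suc m
    |t| = trans (length-++ pre) (trans (ℕP.+-comm (length pre) 1) (cong suc |pre|))
    |ab| : suc (A ℕ.+ length b) ≡ m
    |ab| = trans (sym (trans (length-++ a) (ℕP.+-suc A (length b)))) (trans (cong length (sym split)) |post|)
    walk′ : IsWalk k (V Ψ) (E Ψ) (t ++ a ++ z ∷ b)
    walk′ = subst (IsWalk k (V Ψ) (E Ψ)) shape walk
    t-in-V : All (_∈ V Ψ) t
    t-in-V = AllP.++⁻ˡ t (proj₁ walk′)
    a-in-V : All (_∈ V Ψ) a
    a-in-V = AllP.++⁻ˡ a (AllP.++⁻ʳ t (proj₁ walk′))
    zb-in-V : All (_∈ V Ψ) (z ∷ b)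
    zb-in-V = AllP.++⁻ʳ a (AllP.++⁻ʳ t (proj₁ walk′))
    |a|≤|t| : A ℕ.≤ length t
    |a|≤|t| = ℕP.≤-trans (ℕP.m≤m+n A (length b))
                (ℕP.≤-trans (ℕP.n≤1+n _) (ℕP.≤-trans (ℕP.≤-reflexive |ab|) (ℕP.≤-trans (ℕP.n≤1+n m) (ℕP.≤-reflexive (sym |t|)))))
    window : List (Fin N)
    window = drop A t ++ a ++ z ∷ []
    |window| : length window ≡ k
    |window| = trans (length-window t a z |a|≤|t|) (cong suc |t|)
    walk″ : IsWalk k (V Ψ) (E Ψ) (take A t ++ window ++ b)
    walk″ = subst (IsWalk k (V Ψ) (E Ψ)) (window-split t a z b A) walk′
    tail-connects : LeftConnectable ζ (link Ψ a ₍ z ₎) (drop 1 (drop A t))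
    tail-connects = subst₂ (LeftConnectable ζ) (link-∷ʳ Ψ a z)
                      (trans (cong (λ j → drop j t) (length-++ a)) (sym (drop-drop A 1 t))) holds
    extends : Extender ζ (link Ψ a) (drop A t) z
    extends = window-extender Ψ (drop A t) a z
                (window-unique uniform (take A t) window b walk″ |window|)
                (window-edge {E = E Ψ} (take A t) window b walk″ |window|)
                (All.head zb-in-V) tail-connects

  decompose : ∀ {w} → BadWalk w → ¬ ¬ Decomposition w
  decompose (pre , x , post , refl , |pre| , |post| , walk , x∈R , ¬connects) =
    ¬¬-map (decomposition-at pre x post walk |pre| |post|)
      (boundary-exists (SuffixConnects t) post ¬connects connects-at-post)
    where
    t : List (Fin N)
    t = pre ++ x ∷ []
    drop≡[x] : drop (length post) t ≡ x ∷ []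
    drop≡[x] = trans (cong (λ j → drop j t) (trans |post| (sym |pre|))) (drop-length-++ pre (x ∷ []))
    x∈R-link : x ∈ R (link Ψ post) ⊥
    x∈R-link = ∈-R-link Ψ post ⊥ (last-fresh pre x post walk |pre| |post|)
                 (subst (λ s → x ∈ R Ψ s) (sym (∪-identityˡ (toSub post))) x∈R)
    connects-at-post : SuffixConnects t post
    connects-at-post = subst (LeftConnectable ζ (link Ψ post)) (sym drop≡[x]) x∈R-link

  Decomposed : Set
  Decomposed = Σ (List (Fin N)) Decomposition

  walk-of : Decomposed → List (Fin N)
  walk-of = proj₁

  z-of : Decomposed → Fin N
  z-of (_ , d) = Decomposition.z d

  key : Decomposed → ℕ × List (Fin N)
  key (_ , d) = length a , t ++ a ++ b
    where open Decomposition d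

  keys : List (ℕ × List (Fin N))
  keys = cartesianProduct (upTo m) (words (V Ψ) (m ℕ.+ m))

  length-keys : length keys ≡ m * n ^ (m ℕ.+ m)
  length-keys = trans (length-cartesianProductWith _,_ (upTo m) (words (V Ψ) (m ℕ.+ m)))
                      (cong₂ _*_ (length-upTo m) (length-words (V Ψ) (m ℕ.+ m)))

  key∈keys : ∀ d → key d ∈ₗ keys
  key∈keys (_ , d) =
    ∈-cartesianProduct⁺ (∈-upTo⁺ |a|<m)
      (subst (λ L → t ++ a ++ b ∈ₗ words (V Ψ) L) |tab| (∈-words (V Ψ) (t ++ a ++ b) in-V))
    where
    open Decomposition d
    |a|<m : suc (length a) ℕ.≤ m
    |a|<m = subst (suc (length a) ℕ.≤_) |ab| (ℕ.s≤s (ℕP.m≤m+n (length a) (length b)))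
    |tab| : length (t ++ a ++ b) ≡ m ℕ.+ m
    |tab| =
      begin
        length (t ++ a ++ b)
      ≡⟨ trans (length-++ t) (cong (length t ℕ.+_) (length-++ a)) ⟩
        length t ℕ.+ (length a ℕ.+ length b)
      ≡⟨ cong (ℕ._+ (length a ℕ.+ length b)) |t| ⟩
        suc m ℕ.+ (length a ℕ.+ length b)
      ≡⟨ sym (ℕP.+-suc m (length a ℕ.+ length b)) ⟩
        m ℕ.+ suc (length a ℕ.+ length b)
      ≡⟨ cong (m ℕ.+_) |ab| ⟩
        m ℕ.+ m
      ∎
      where open ≡-Reasoning

  FitsKeyOf : Decomposed → List (Fin N) → Fin N → Set
  FitsKeyOf (_ , d₀) w y = (w ≡ t ++ a ++ y ∷ b) × Extender ζ (link Ψ a) (drop (length a) t) y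
    where open Decomposition d₀ using (t; a; b)

  fits : ∀ {w t a b t′ a′ b′ : List (Fin N)} {z} → t ≡ t′ → a ≡ a′ → b ≡ b′ →
    w ≡ t ++ a ++ z ∷ b → Extender ζ (link Ψ a) (drop (length a) t) z →
    (w ≡ t′ ++ a′ ++ z ∷ b′) × Extender ζ (link Ψ a′) (drop (length a′) t′) z
  fits refl refl refl shape extends = shape , extends

  same-key : ∀ d d₀ → key d ≡ key d₀ → FitsKeyOf d₀ (walk-of d) (z-of d)
  same-key (_ , d) (_ , d₀) same = fits t≡ a≡ b≡ (shape d) (extends d)
    where
    open Decomposition
    t-split : t d ≡ t d₀ × a d ++ b d ≡ a d₀ ++ b d₀
    t-split = ++-injective (t d) (t d₀) (trans (|t| d) (sym (|t| d₀))) (cong proj₂ same)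
    t≡ : t d ≡ t d₀
    t≡ = proj₁ t-split
    a-split : a d ≡ a d₀ × b d ≡ b d₀
    a-split = ++-injective (a d) (a d₀) (cong proj₁ same) (proj₂ t-split)
    a≡ : a d ≡ a d₀
    a≡ = proj₁ a-split
    b≡ : b d ≡ b d₀
    b≡ = proj₂ a-split

  -- Walks with a common key are determined by their z, which extends a fixed
  -- non-left-connectable tuple: there are at most ζn of them.
  fibre-bound : 0ℚ ≤ ζ → ∀ κ (ds : List Decomposed) → AllPairs (λ d d′ → walk-of d ≢ walk-of d′) ds →
    All (λ d → key d ≡ κ) ds → ℕ→ℚ (length ds) ≤ ζ *ℚ ℕ→ℚ n
  fibre-bound ζ≥0 κ [] _ _ = 0≤ζ* ζ≥0 n
  fibre-bound ζ≥0 κ ds@(d₀ ∷ _) distinct same-κ =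
    begin
      ℕ→ℚ (length ds)
    ≡⟨ cong ℕ→ℚ (sym (length-map z-of ds)) ⟩
      ℕ→ℚ (length (map z-of ds))
    ≤⟨ few-extenders ζ≥0 (link Ψ a) (drop (length a) t) fails (map z-of ds) zs-unique zs-extend ⟩
      ζ *ℚ ℕ→ℚ ∣ V (link Ψ a) ∣
    ≤⟨ ζ*-mono ζ≥0 (∣V-link∣≤ Ψ a) ⟩
      ζ *ℚ ℕ→ℚ n
    ∎
    where
    open ℚP.≤-Reasoning
    open Decomposition (proj₂ d₀)
    fitting : All (λ d → FitsKeyOf d₀ (walk-of d) (z-of d)) ds
    fitting = All.map (λ {d} κ≡ → same-key d d₀ (trans κ≡ (sym (All.head same-κ)))) same-κ
    zs-extend : All (Extender ζ (link Ψ a) (drop (length a) t)) (map z-of ds)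
    zs-extend = AllP.map⁺ (All.map proj₂ fitting)
    walks≡ : map walk-of ds ≡ map (λ y → t ++ a ++ y ∷ b) (map z-of ds)
    walks≡ = trans (ListP.map-cong-local (All.map proj₁ fitting)) (ListP.map-∘ ds)
    zs-unique : Unique (map z-of ds)
    zs-unique = UniqueP.map⁻ (subst Unique walks≡ (AllPairsP.map⁺ distinct))

  count : 0ℚ ≤ ζ → (ds : List Decomposed) → AllPairs (λ d d′ → walk-of d ≢ walk-of d′) ds →
    ℕ→ℚ (length ds) ≤ ℕ→ℚ m *ℚ ζ *ℚ ℕ→ℚ (n ^ suc (m ℕ.+ m))
  count ζ≥0 ds distinct =
    begin
      ℕ→ℚ (length ds)
    ≤⟨ count-by-key key-≟ key _ (ζ *ℚ ℕ→ℚ n) keys ds distinct (All.tabulate (λ {d} _ → key∈keys d)) (fibre-bound ζ≥0) ⟩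
      ℕ→ℚ (length keys) *ℚ (ζ *ℚ ℕ→ℚ n)
    ≡⟨ cong (λ L → ℕ→ℚ L *ℚ (ζ *ℚ ℕ→ℚ n)) length-keys ⟩
      ℕ→ℚ (m * X) *ℚ (ζ *ℚ ℕ→ℚ n)
    ≡⟨ cong (_*ℚ (ζ *ℚ ℕ→ℚ n)) (ℕ→ℚ-* m X) ⟩
      ℕ→ℚ m *ℚ ℕ→ℚ X *ℚ (ζ *ℚ ℕ→ℚ n)
    ≡⟨ solve 4 (λ M X z n → M :* X :* (z :* n) := M :* z :* (n :* X)) refl (ℕ→ℚ m) (ℕ→ℚ X) ζ (ℕ→ℚ n) ⟩
      ℕ→ℚ m *ℚ ζ *ℚ (ℕ→ℚ n *ℚ ℕ→ℚ X)
    ≡⟨ cong (ℕ→ℚ m *ℚ ζ *ℚ_) (sym (ℕ→ℚ-* n X)) ⟩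
      ℕ→ℚ m *ℚ ζ *ℚ ℕ→ℚ (n ^ suc (m ℕ.+ m))
    ∎
    where
    open ℚP.≤-Reasoning
    open +-*-Solver
    X : ℕ
    X = n ^ (m ℕ.+ m)
    key-≟ : DecidableEquality (ℕ × List (Fin N))
    key-≟ = ProductP.≡-dec ℕ._≟_ (ListP.≡-dec _≟_)

  bad-walks-bound : 0ℚ < ζ → (ws : List (List (Fin N))) → Unique ws → All BadWalk ws →
    ℕ→ℚ (length ws) ≤ ℕ→ℚ m *ℚ ζ *ℚ ℕ→ℚ (n ^ suc (m ℕ.+ m))
  bad-walks-bound ζ>0 ws unique bad =
    decidable-stable (_ ℚP.≤? _) (¬¬-map from-decompositions (All-¬¬ decompose bad))
    where
    from-decompositions : All Decomposition ws → ℕ→ℚ (length ws) ≤ ℕ→ℚ m *ℚ ζ *ℚ ℕ→ℚ (n ^ suc (m ℕ.+ m))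
    from-decompositions decompositions =
      subst (λ L → ℕ→ℚ L ≤ _) (trans (sym (length-map proj₁ ds)) (cong length walks≡))
        (count (ℚP.<⇒≤ ζ>0) ds (AllPairsP.map⁻ (subst Unique (sym walks≡) unique)))
      where
      ds : List Decomposed
      ds = All.toList decompositions
      walks≡ : map proj₁ ds ≡ ws
      walks≡ = map-proj₁-toList decompositions

exponent : ∀ m → 2 * suc (suc m) ∸ 3 ≡ suc (m ℕ.+ m)
exponent m = cong (_∸ 1) (doubling m)
  where
  doubling : ∀ m → m ℕ.+ suc (suc (m ℕ.+ 0)) ≡ suc (suc (m ℕ.+ m))
  doubling = solve-∀

lemma2p20 : ∀ {N : ℕ} (k : ℕ) (ζ : ℚ) (Ψ : Constellation N)
    → IsConstellation k Ψ
    → 0ℚ < ζ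
    → (ws : List (List (Fin N)))
    → Unique ws
    → All (λ w → Σ (List (Fin N)) λ pre → Σ (Fin N) λ x → Σ (List (Fin N)) λ post →
             (w ≡ pre ++ (x ∷ post))
             × (length pre ≡ k ∸ 2)
             × (length post ≡ k ∸ 2)
             × IsWalk k (V Ψ) (E Ψ) w
             × (x ∈ R Ψ (toSub post))
             × ¬ LeftConnectable ζ Ψ (pre ++ (x ∷ []))) ws
    → ℕ→ℚ (length ws) ≤ ℕ→ℚ (k ∸ 2) *ℚ ζ *ℚ ℕ→ℚ (∣ V Ψ ∣ ^ (2 * k ∸ 3))
lemma2p20 zero ζ Ψ (() , _) _ _ _ _
lemma2p20 (suc zero) ζ Ψ (ℕ.s≤s () , _) _ _ _ _
lemma2p20 (suc (suc m)) ζ Ψ (_ , edges , _) ζ>0 ws unique bad =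
  subst (λ e → ℕ→ℚ (length ws) ≤ ℕ→ℚ m *ℚ ζ *ℚ ℕ→ℚ (∣ V Ψ ∣ ^ e)) (sym (exponent m))
    (BadWalks.bad-walks-bound m ζ Ψ (λ e e∈E → proj₁ (edges e e∈E)) ζ>0 ws unique bad)
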